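{- Let $n, \ell, k \in \mathbb{N}^+$ with $\ell + k - 1 \le n \le \ell k$. Then $$M_{n,\ell,k} = \sum_{t=1}^{\ell}(-1)^{t-1}\binom{\ell}{t}R_{n-t(k-1)-\ell,\;\ell-t,\;k-1}.$$
   Context: $M_{n,\ell,k}$ is the number of $(x_1,\dots,x_\ell)\in(\mathbb{Z}_{>0})^\ell$ with $\sum x_i = n$ and $\max_i x_i = k$ (ways to split $n$ balls into exactly $\ell$ nonempty ordered bins with the most crowded bin having exactly $k$ balls). For integers $m$, $L\ge 0$, $r$, $R_{m,L,r}$ is the number of $(b_1,\dots,b_L)\in(\mathbb{Z}_{\ge 0})^L$ with $\sum b_i = m$ and $b_i \le r$ for all $i$ (so $R_{m,L,r}=0$ if $m<0$, and $R_{m,0,r}$ equals $1$ if $m=0$ and $0$ otherwise). Binomial coefficients follow the convention $\binom{a}{b} = \frac{a!}{b!(a-b)!}$ if $a\ge 0$, $b\ge 0$, $a\ge b$, and $0$ otherwise. -}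

module Defs where

open import Data.Nat using (ℕ; zero; suc; _+_; _*_; _∸_; _⊔_; _≟_)
open import Data.Integer as ℤ using (ℤ; +_; -[1+_])
open import Data.List using (List; []; _∷_; map; concatMap; length; filter; upTo; foldr)
open import Data.Nat.ListAction using (sum)
open import Data.Nat.Combinatorics using (_C_)
open import Relation.Nullary.Decidable using (_×-dec_)

tuples : (L : ℕ) → List ℕ → List (List ℕ)
tuples zero    xs = [] ∷ []
tuples (suc L) xs = concatMap (λ x → map (x ∷_) (tuples L xs)) xs

maxL : List ℕ → ℕ
maxL = foldr _⊔_ 0

-- M n ℓ k : number of (x₁,…,x_ℓ) ∈ (ℤ_{>0})^ℓ with Σ xᵢ = n and max xᵢ = k.
-- Any such tuple has entries in {1,…,n}, so we enumerate {1,…,n}^ℓ.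
M : ℕ → ℕ → ℕ → ℕ
M n ℓ k = length (filter (λ xs → (sum xs ≟ n) ×-dec (maxL xs ≟ k))
                         (tuples ℓ (map suc (upTo n))))

Rℕ : ℕ → ℕ → ℕ → ℕ
Rℕ m L r = length (filter (λ bs → sum bs ≟ m) (tuples L (upTo (suc r))))

R : ℤ → ℕ → ℕ → ℤ
R (+ m)    L r = + Rℕ m L r
R -[1+ _ ] L r = + 0

sgn : ℕ → ℤ
sgn zero    = + 1
sgn (suc j) = ℤ.- sgn j

sumFrom1 : ℕ → (ℕ → ℤ) → ℤ
sumFrom1 zero    f = + 0
sumFrom1 (suc ℓ) f = sumFrom1 ℓ f ℤ.+ f (suc ℓ)

-- Write W j ℓ m for the number of ℓ-tuples with entries in {0,…,j−1} and sum m, so that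
-- R_{m,ℓ,r} = W (r+1) ℓ m.  Subtracting 1 from every entry shows that the ℓ-tuples of positive
-- integers with sum n and maximum at most j are counted by W j ℓ (n − ℓ), hence
-- M_{n,ℓ,k} = W k ℓ (n − ℓ) − W (k−1) ℓ (n − ℓ).  With c = k − 1, both W k ℓ m − W c ℓ m and the
-- alternating sum A ℓ m on the right-hand side (with m = n − ℓ) satisfy
--   X (ℓ+1) m = Σ_{b<c} X ℓ (m − b) + W k ℓ (m − c)
-- (classifying tuples by their first entry, resp. Pascal's rule), and both vanish for ℓ = 0.
module Submission where

open import Data.Nat using (ℕ; zero; suc; _+_; _*_; _∸_; _≤_; _<_; _⊔_; z≤n; s≤s; _≤?_; NonZero)
import Data.Nat as ℕ
import Data.Nat.Properties as ℕP
open import Data.Nat.ListAction using (sum)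
open import Data.Nat.Combinatorics using (_C_; nCk+nC[k+1]≡[n+1]C[k+1]; k>n⇒nCk≡0)
open import Data.Integer as ℤ using (ℤ; +_; -[1+_])
import Data.Integer.Properties as ℤP
open import Data.Integer.Tactic.RingSolver using (solve-∀)
open import Algebra.Properties.CommutativeSemigroup ℤP.+-commutativeSemigroup using (interchange)
open import Data.List using (List; []; _∷_; map; concatMap; length; filter; upTo; applyUpTo; _++_)
open import Data.List.Properties using (filter-++; length-++; filter-none; filter-≐; map-upTo)
open import Data.List.Relation.Unary.All using (universal)
open import Data.Product using (_×_; _,_; proj₁; proj₂)
open import Function using (_∘_)
open import Level using (0ℓ)
open import Relation.Nullary using (¬_; yes; no)
open import Relation.Nullary.Decidable using (_×-dec_; ¬?)
open import Relation.Unary using (Pred; Decidable; _≐_)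
open import Relation.Binary.PropositionalEquality
open ≡-Reasoning

open import Defs

n≡m+n-m : ∀ (m n : ℤ) → n ≡ m ℤ.+ n ℤ.- m
n≡m+n-m = solve-∀

m+[n-m]≡n : ∀ (m n : ℤ) → m ℤ.+ (n ℤ.- m) ≡ n
m+[n-m]≡n = solve-∀

m-n-o≡m-o-n : ∀ (m n o : ℤ) → m ℤ.- n ℤ.- o ≡ m ℤ.- o ℤ.- n
m-n-o≡m-o-n = solve-∀

module _ {A : Set} where

  count : {P : Pred A 0ℓ} → Decidable P → List A → ℕ
  count P? xs = length (filter P? xs)

  count-++ : {P : Pred A 0ℓ} (P? : Decidable P) (xs ys : List A) →
             count P? (xs ++ ys) ≡ count P? xs + count P? ys
  count-++ P? xs ys = trans (cong length (filter-++ P? xs ys)) (length-++ (filter P? xs))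

  count-≐ : {P Q : Pred A 0ℓ} (P? : Decidable P) (Q? : Decidable Q) → P ≐ Q →
            (xs : List A) → count P? xs ≡ count Q? xs
  count-≐ P? Q? P≐Q xs = cong length (filter-≐ P? Q? P≐Q xs)

  count-none : {P : Pred A 0ℓ} (P? : Decidable P) → (∀ x → ¬ P x) → (xs : List A) → count P? xs ≡ 0
  count-none P? ¬P xs = cong length (filter-none P? (universal ¬P xs))

  count-split : {P Q : Pred A 0ℓ} (P? : Decidable P) (Q? : Decidable Q) (xs : List A) →
                count P? xs ≡ count (λ x → P? x ×-dec Q? x) xs + count (λ x → P? x ×-dec ¬? (Q? x)) xs
  count-split P? Q? [] = refl
  count-split P? Q? (x ∷ xs) with P? x | Q? x
  ... | yes _ | yes _ = cong suc (count-split P? Q? xs)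
  ... | yes _ | no _  = trans (cong suc (count-split P? Q? xs)) (sym (ℕP.+-suc _ _))
  ... | no _  | _     = count-split P? Q? xs

  count-≡suc : {P : Pred A 0ℓ} (P? : Decidable P) (f : A → ℕ) (c : ℕ) (xs : List A) →
    + count (λ x → P? x ×-dec (f x ℕ.≟ suc c)) xs ≡
    + count (λ x → P? x ×-dec (f x ≤? suc c)) xs ℤ.- + count (λ x → P? x ×-dec (f x ≤? c)) xs
  count-≡suc {P} P? f c xs = begin
      + exact
    ≡⟨ n≡m+n-m (+ below) (+ exact) ⟩
      + below ℤ.+ + exact ℤ.- + below
    ≡⟨ cong (ℤ._- + below) (sym (ℤP.pos-+ below exact)) ⟩
      + (below + exact) ℤ.- + below
    ≡⟨ cong (λ s → + s ℤ.- + below) (sym split) ⟩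
      + count P≤k? xs ℤ.- + below
    ∎
    where
    P≤k? = λ x → P? x ×-dec (f x ≤? suc c)
    below = count (λ x → P? x ×-dec (f x ≤? c)) xs
    exact = count (λ x → P? x ×-dec (f x ℕ.≟ suc c)) xs
    ≤c≐ : (λ x → (P x × f x ≤ suc c) × f x ≤ c) ≐ (λ x → P x × f x ≤ c)
    ≤c≐ = (λ ((p , _) , ≤c) → p , ≤c) , (λ (p , ≤c) → (p , ℕP.m≤n⇒m≤1+n ≤c) , ≤c)
    ≡k≐ : (λ x → (P x × f x ≤ suc c) × ¬ f x ≤ c) ≐ (λ x → P x × f x ≡ suc c)
    ≡k≐ = (λ ((p , ≤k) , ≰c) → p , ℕP.≤-antisym ≤k (ℕP.≰⇒> ≰c)) ,
          (λ (p , ≡k) → (p , ℕP.≤-reflexive ≡k) , λ ≤c → ℕP.<-irrefl refl (subst (_≤ c) ≡k ≤c))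
    split : count P≤k? xs ≡ below + exact
    split = trans (count-split P≤k? (λ x → f x ≤? c) xs) (cong₂ _+_ (count-≐ _ _ ≤c≐ xs) (count-≐ _ _ ≡k≐ xs))

∑< : ℕ → (ℕ → ℤ) → ℤ
∑< zero    f = + 0
∑< (suc n) f = f 0 ℤ.+ ∑< n (f ∘ suc)

infixl 10 ∑<
syntax ∑< n (λ i → e) = ∑[ i < n ] e

∑-cong : ∀ n {f g : ℕ → ℤ} → (∀ i → i < n → f i ≡ g i) → ∑< n f ≡ ∑< n g
∑-cong zero    f≡g = refl
∑-cong (suc n) f≡g = cong₂ ℤ._+_ (f≡g 0 (s≤s z≤n)) (∑-cong n (λ i i<n → f≡g (suc i) (s≤s i<n)))

∑-zero : ∀ n {f : ℕ → ℤ} → (∀ i → f i ≡ + 0) → ∑< n f ≡ + 0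
∑-zero zero    f≡0 = refl
∑-zero (suc n) f≡0 = cong₂ ℤ._+_ (f≡0 0) (∑-zero n (f≡0 ∘ suc))

∑-truncate : ∀ {k n} (f : ℕ → ℤ) → k ≤ n → (∀ i → k ≤ i → f i ≡ + 0) → ∑< n f ≡ ∑< k f
∑-truncate {zero}  {n}     f _         f≡0 = ∑-zero n (λ i → f≡0 i z≤n)
∑-truncate {suc k} {suc n} f (s≤s k≤n) f≡0 =
  cong (λ s → f 0 ℤ.+ s) (∑-truncate (f ∘ suc) k≤n (λ i k≤i → f≡0 (suc i) (s≤s k≤i)))

∑-init-last : ∀ n (f : ℕ → ℤ) → ∑< (suc n) f ≡ ∑< n f ℤ.+ f n
∑-init-last zero    f = trans (ℤP.+-identityʳ (f 0)) (sym (ℤP.+-identityˡ (f 0)))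
∑-init-last (suc n) f =
  trans (cong (λ s → f 0 ℤ.+ s) (∑-init-last n (f ∘ suc))) (sym (ℤP.+-assoc (f 0) _ _))

∑-distrib-+ : ∀ n (f g : ℕ → ℤ) → ∑[ i < n ] (f i ℤ.+ g i) ≡ ∑< n f ℤ.+ ∑< n g
∑-distrib-+ zero    f g = refl
∑-distrib-+ (suc n) f g =
  trans (cong (λ s → f 0 ℤ.+ g 0 ℤ.+ s) (∑-distrib-+ n (f ∘ suc) (g ∘ suc)))
        (interchange (f 0) (g 0) (∑< n (f ∘ suc)) (∑< n (g ∘ suc)))

∑-distrib-- : ∀ n (f g : ℕ → ℤ) → ∑[ i < n ] (f i ℤ.- g i) ≡ ∑< n f ℤ.- ∑< n g
∑-distrib-- zero    f g = refl
∑-distrib-- (suc n) f g =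
  trans (cong (λ s → f 0 ℤ.- g 0 ℤ.+ s) (∑-distrib-- n (f ∘ suc) (g ∘ suc)))
        (sub-interchange (f 0) (g 0) (∑< n (f ∘ suc)) (∑< n (g ∘ suc)))
  where
  sub-interchange : ∀ (a b c d : ℤ) → (a ℤ.- b) ℤ.+ (c ℤ.- d) ≡ (a ℤ.+ c) ℤ.- (b ℤ.+ d)
  sub-interchange = solve-∀

∑-*ˡ : ∀ n (a : ℤ) (f : ℕ → ℤ) → ∑[ i < n ] (a ℤ.* f i) ≡ a ℤ.* ∑< n f
∑-*ˡ zero    a f = sym (ℤP.*-zeroʳ a)
∑-*ˡ (suc n) a f =
  trans (cong (λ s → a ℤ.* f 0 ℤ.+ s) (∑-*ˡ n a (f ∘ suc))) (sym (ℤP.*-distribˡ-+ a _ _))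

sumFrom1-cong : ∀ ℓ {f g : ℕ → ℤ} → (∀ t → 1 ≤ t → t ≤ ℓ → f t ≡ g t) → sumFrom1 ℓ f ≡ sumFrom1 ℓ g
sumFrom1-cong zero    f≡g = refl
sumFrom1-cong (suc ℓ) f≡g =
  cong₂ ℤ._+_ (sumFrom1-cong ℓ (λ t 1≤t t≤ℓ → f≡g t 1≤t (ℕP.m≤n⇒m≤1+n t≤ℓ))) (f≡g (suc ℓ) (s≤s z≤n) ℕP.≤-refl)

sumFrom1-distrib-+ : ∀ ℓ (f g : ℕ → ℤ) → sumFrom1 ℓ (λ t → f t ℤ.+ g t) ≡ sumFrom1 ℓ f ℤ.+ sumFrom1 ℓ g
sumFrom1-distrib-+ zero    f g = refl
sumFrom1-distrib-+ (suc ℓ) f g =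
  trans (cong (ℤ._+ (f (suc ℓ) ℤ.+ g (suc ℓ))) (sumFrom1-distrib-+ ℓ f g))
        (interchange (sumFrom1 ℓ f) (sumFrom1 ℓ g) (f (suc ℓ)) (g (suc ℓ)))

sumFrom1-neg : ∀ ℓ (f : ℕ → ℤ) → sumFrom1 ℓ (λ t → ℤ.- f t) ≡ ℤ.- sumFrom1 ℓ f
sumFrom1-neg zero    f = refl
sumFrom1-neg (suc ℓ) f =
  trans (cong (λ s → s ℤ.+ ℤ.- f (suc ℓ)) (sumFrom1-neg ℓ f)) (sym (ℤP.neg-distrib-+ (sumFrom1 ℓ f) (f (suc ℓ))))

sumFrom1-head : ∀ ℓ (f : ℕ → ℤ) → sumFrom1 (suc ℓ) f ≡ f 1 ℤ.+ sumFrom1 ℓ (f ∘ suc)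
sumFrom1-head zero    f = trans (ℤP.+-identityˡ (f 1)) (sym (ℤP.+-identityʳ (f 1)))
sumFrom1-head (suc ℓ) f =
  trans (cong (ℤ._+ f (suc (suc ℓ))) (sumFrom1-head ℓ f)) (ℤP.+-assoc (f 1) _ _)

sumFrom1-∑-comm : ∀ ℓ n (f : ℕ → ℕ → ℤ) →
                  sumFrom1 ℓ (λ t → ∑[ b < n ] f t b) ≡ ∑[ b < n ] sumFrom1 ℓ (λ t → f t b)
sumFrom1-∑-comm zero    n f = sym (∑-zero n (λ _ → refl))
sumFrom1-∑-comm (suc ℓ) n f =
  trans (cong (ℤ._+ ∑< n (f (suc ℓ))) (sumFrom1-∑-comm ℓ n f)) (sym (∑-distrib-+ n _ _))

count-concatMap-cons : ∀ {P : Pred (List ℕ) 0ℓ} (P? : Decidable P) (T : List (List ℕ)) (g : ℕ → ℕ) n →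
  + count P? (concatMap (λ x → map (x ∷_) T) (applyUpTo g n)) ≡ ∑[ i < n ] (+ count (P? ∘ (g i ∷_)) T)
count-concatMap-cons P? T g zero    = refl
count-concatMap-cons P? T g (suc n) = begin
    + count P? (map (g 0 ∷_) T ++ rest)
  ≡⟨ cong +_ (count-++ P? (map (g 0 ∷_) T) rest) ⟩
    + (count P? (map (g 0 ∷_) T) + count P? rest)
  ≡⟨ ℤP.pos-+ (count P? (map (g 0 ∷_) T)) (count P? rest) ⟩
    + count P? (map (g 0 ∷_) T) ℤ.+ + count P? rest
  ≡⟨ cong₂ ℤ._+_ (cong +_ (count-map T)) (count-concatMap-cons P? T (g ∘ suc) n) ⟩
    ∑[ i < suc n ] (+ count (P? ∘ (g i ∷_)) T)
  ∎
  where
  rest = concatMap (λ x → map (x ∷_) T) (applyUpTo (g ∘ suc) n)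
  count-map : ∀ zss → count P? (map (g 0 ∷_) zss) ≡ count (P? ∘ (g 0 ∷_)) zss
  count-map []        = refl
  count-map (zs ∷ zss) with P? (g 0 ∷ zs)
  ... | yes _ = cong suc (count-map zss)
  ... | no _  = count-map zss

count-tuples : ∀ {P : Pred (List ℕ) 0ℓ} (P? : Decidable P) L (g : ℕ → ℕ) n →
  + count P? (tuples (suc L) (applyUpTo g n)) ≡ ∑[ i < n ] (+ count (P? ∘ (g i ∷_)) (tuples L (applyUpTo g n)))
count-tuples P? L g n = count-concatMap-cons P? (tuples L (applyUpTo g n)) g n

cons-sum≐ : ∀ x m → (λ zs → + sum (x ∷ zs) ≡ m) ≐ (λ zs → + sum zs ≡ m ℤ.- + x)
cons-sum≐ x m = (λ {zs} → to zs) , (λ {zs} → from zs)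
  where
  to : ∀ zs → + (x + sum zs) ≡ m → + sum zs ≡ m ℤ.- + x
  to zs e = trans (n≡m+n-m (+ x) (+ sum zs)) (cong (ℤ._- + x) (trans (sym (ℤP.pos-+ x (sum zs))) e))
  from : ∀ zs → + sum zs ≡ m ℤ.- + x → + (x + sum zs) ≡ m
  from zs e = trans (ℤP.pos-+ x (sum zs)) (trans (cong (λ s → + x ℤ.+ s) e) (m+[n-m]≡n (+ x) m))

weakComp< : ℕ → ℕ → ℤ → ℤ
weakComp< j ℓ m = + count (λ bs → + sum bs ℤ.≟ m) (tuples ℓ (upTo j))

weakComp<-rec : ∀ j ℓ m → weakComp< j (suc ℓ) m ≡ ∑[ b < j ] weakComp< j ℓ (m ℤ.- + b)
weakComp<-rec j ℓ m =
  trans (count-tuples P? ℓ (λ b → b) j) (∑-cong j (λ b _ → cong +_ (count-≐ _ _ (cons-sum≐ b m) T)))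
  where
  P? = λ (bs : List ℕ) → + sum bs ℤ.≟ m
  T  = tuples ℓ (upTo j)

R≡weakComp< : ∀ m L r → R m L r ≡ weakComp< (suc r) L m
R≡weakComp< (+ m)    L r =
  cong +_ (count-≐ (λ bs → sum bs ℕ.≟ m) _ (cong (λ s → + s) , ℤP.+-injective) (tuples L (upTo (suc r))))
R≡weakComp< -[1+ j ] L r =
  cong +_ (sym (count-none (λ bs → + sum bs ℤ.≟ -[1+ j ]) (λ _ ()) (tuples L (upTo (suc r)))))

R-rec : ∀ m L c → R m (suc L) c ≡ ∑[ b < suc c ] R (m ℤ.- + b) L c
R-rec m L c = begin
  R m (suc L) c                              ≡⟨ R≡weakComp< m (suc L) c ⟩
  weakComp< (suc c) (suc L) m                ≡⟨ weakComp<-rec (suc c) L m ⟩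
  ∑[ b < suc c ] weakComp< (suc c) L (m ℤ.- + b)
    ≡⟨ ∑-cong (suc c) (λ b _ → sym (R≡weakComp< (m ℤ.- + b) L c)) ⟩
  ∑[ b < suc c ] R (m ℤ.- + b) L c           ∎

boundedComp : ℕ → ℕ → ℕ → ℤ → ℤ
boundedComp n j ℓ m = + count (λ xs → (+ sum xs ℤ.≟ m) ×-dec (maxL xs ≤? j)) (tuples ℓ (applyUpTo suc n))

boundedComp≡weakComp< : ∀ {n j} → j ≤ n → ∀ ℓ m → boundedComp n j ℓ m ≡ weakComp< j ℓ (m ℤ.- + ℓ)
boundedComp≡weakComp< j≤n zero m rewrite ℤP.+-identityʳ m with + 0 ℤ.≟ m
... | yes _ = refl
... | no _  = refl
boundedComp≡weakComp< {n} {j} j≤n (suc ℓ) m = begin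
    boundedComp n j (suc ℓ) m
  ≡⟨ count-tuples P? ℓ suc n ⟩
    ∑< n byHead
  ≡⟨ ∑-truncate byHead j≤n (λ i j≤i → cong +_ (count-none (P? ∘ (suc i ∷_)) (head-too-big j≤i) T)) ⟩
    ∑< j byHead
  ≡⟨ ∑-cong j (λ i i<j → cong +_ (count-≐ (P? ∘ (suc i ∷_)) _ (head-allowed i<j) T)) ⟩
    ∑[ i < j ] boundedComp n j ℓ (m ℤ.- + suc i)
  ≡⟨ ∑-cong j (λ i _ → trans (boundedComp≡weakComp< j≤n ℓ (m ℤ.- + suc i)) (cong (weakComp< j ℓ) (reindex m (+ i) (+ ℓ)))) ⟩
    ∑[ i < j ] weakComp< j ℓ (m ℤ.- + suc ℓ ℤ.- + i)
  ≡⟨ sym (weakComp<-rec j ℓ (m ℤ.- + suc ℓ)) ⟩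
    weakComp< j (suc ℓ) (m ℤ.- + suc ℓ)
  ∎
  where
  P? = λ (xs : List ℕ) → (+ sum xs ℤ.≟ m) ×-dec (maxL xs ≤? j)
  T  = tuples ℓ (applyUpTo suc n)
  byHead : ℕ → ℤ
  byHead i = + count (P? ∘ (suc i ∷_)) T
  head-too-big : ∀ {i} → j ≤ i → ∀ zs → ¬ (+ sum (suc i ∷ zs) ≡ m × suc i ⊔ maxL zs ≤ j)
  head-too-big {i} j≤i zs (_ , ≤j) = ℕP.<⇒≱ (s≤s j≤i) (ℕP.m⊔n≤o⇒m≤o (suc i) (maxL zs) ≤j)
  head-allowed : ∀ {i} → suc i ≤ j →
    (λ zs → + sum (suc i ∷ zs) ≡ m × suc i ⊔ maxL zs ≤ j) ≐ (λ zs → + sum zs ≡ m ℤ.- + suc i × maxL zs ≤ j)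
  head-allowed {i} i<j =
    (λ {zs} (e , ≤j) → proj₁ (cons-sum≐ (suc i) m) {zs} e , ℕP.m⊔n≤o⇒n≤o (suc i) (maxL zs) ≤j) ,
    (λ {zs} (e , ≤j) → proj₂ (cons-sum≐ (suc i) m) {zs} e , ℕP.⊔-lub i<j ≤j)
  reindex : ∀ (a b d : ℤ) → a ℤ.- (+ 1 ℤ.+ b) ℤ.- d ≡ a ℤ.- (+ 1 ℤ.+ d) ℤ.- b
  reindex = solve-∀

alternatingSum : ℕ → ℕ → ℤ → ℤ
alternatingSum c ℓ m = sumFrom1 ℓ (λ t → sgn (t ∸ 1) ℤ.* (+ (ℓ C t)) ℤ.* R (m ℤ.- + (t * c)) (ℓ ∸ t) c)

alternatingSum-rec : ∀ c ℓ m →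
  alternatingSum c (suc ℓ) m ≡ ∑[ b < c ] alternatingSum c ℓ (m ℤ.- + b) ℤ.+ R (m ℤ.- + c) ℓ c
alternatingSum-rec c ℓ m = begin
    alternatingSum c (suc ℓ) m
  ≡⟨ sumFrom1-cong (suc ℓ) pascal ⟩
    sumFrom1 (suc ℓ) (λ t → f₁ t ℤ.+ f₂ t)
  ≡⟨ sumFrom1-distrib-+ (suc ℓ) f₁ f₂ ⟩
    sumFrom1 (suc ℓ) f₁ ℤ.+ sumFrom1 (suc ℓ) f₂
  ≡⟨ cong₂ ℤ._+_ first-half second-half ⟩
    (∑< c A ℤ.+ A c) ℤ.+ (R (m ℤ.- + c) ℓ c ℤ.- A c)
  ≡⟨ cancel (∑< c A) (A c) (R (m ℤ.- + c) ℓ c) ⟩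
    ∑< c A ℤ.+ R (m ℤ.- + c) ℓ c
  ∎
  where
  σ : ℕ → ℤ
  σ t = sgn (t ∸ 1)
  A : ℕ → ℤ
  A b = alternatingSum c ℓ (m ℤ.- + b)
  term : ℕ → ℕ → ℤ
  term t b = σ t ℤ.* (+ (ℓ C t)) ℤ.* R (m ℤ.- + b ℤ.- + (t * c)) (ℓ ∸ t) c
  f₁ f₂ : ℕ → ℤ
  f₁ t = σ t ℤ.* (+ (ℓ C t)) ℤ.* R (m ℤ.- + (t * c)) (suc ℓ ∸ t) c
  f₂ t = σ t ℤ.* (+ (ℓ C (t ∸ 1))) ℤ.* R (m ℤ.- + (t * c)) (suc ℓ ∸ t) c

  cancel : ∀ (s a r : ℤ) → (s ℤ.+ a) ℤ.+ (r ℤ.- a) ≡ s ℤ.+ r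
  cancel = solve-∀
  distrib : ∀ (s a b x : ℤ) → s ℤ.* (a ℤ.+ b) ℤ.* x ≡ s ℤ.* a ℤ.* x ℤ.+ s ℤ.* b ℤ.* x
  distrib = solve-∀
  sub-+ : ∀ (m c d : ℤ) → m ℤ.- (c ℤ.+ d) ≡ m ℤ.- c ℤ.- d
  sub-+ = solve-∀
  neg-* : ∀ (s a x : ℤ) → ℤ.- s ℤ.* a ℤ.* x ≡ ℤ.- (s ℤ.* a ℤ.* x)
  neg-* = solve-∀

  pascal : ∀ t → 1 ≤ t → t ≤ suc ℓ →
    σ t ℤ.* (+ (suc ℓ C t)) ℤ.* R (m ℤ.- + (t * c)) (suc ℓ ∸ t) c ≡ f₁ t ℤ.+ f₂ t
  pascal (suc u) _ _ = begin
      σ (suc u) ℤ.* (+ (suc ℓ C suc u)) ℤ.* X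
    ≡⟨ cong (λ z → σ (suc u) ℤ.* + z ℤ.* X) (sym (trans (ℕP.+-comm (ℓ C suc u) (ℓ C u)) (nCk+nC[k+1]≡[n+1]C[k+1] ℓ u))) ⟩
      σ (suc u) ℤ.* (+ (ℓ C suc u + ℓ C u)) ℤ.* X
    ≡⟨ cong (λ z → σ (suc u) ℤ.* z ℤ.* X) (ℤP.pos-+ (ℓ C suc u) (ℓ C u)) ⟩
      σ (suc u) ℤ.* (+ (ℓ C suc u) ℤ.+ + (ℓ C u)) ℤ.* X
    ≡⟨ distrib (σ (suc u)) (+ (ℓ C suc u)) (+ (ℓ C u)) X ⟩
      f₁ (suc u) ℤ.+ f₂ (suc u)
    ∎
    where X = R (m ℤ.- + (suc u * c)) (suc ℓ ∸ suc u) c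

  expand : ∀ t → 1 ≤ t → t ≤ ℓ → f₁ t ≡ ∑[ b < suc c ] term t b
  expand t _ t≤ℓ rewrite ℕP.+-∸-assoc 1 t≤ℓ = begin
      σ t ℤ.* (+ (ℓ C t)) ℤ.* R (m ℤ.- + (t * c)) (suc (ℓ ∸ t)) c
    ≡⟨ cong (λ z → σ t ℤ.* (+ (ℓ C t)) ℤ.* z) (R-rec (m ℤ.- + (t * c)) (ℓ ∸ t) c) ⟩
      σ t ℤ.* (+ (ℓ C t)) ℤ.* (∑[ b < suc c ] R (m ℤ.- + (t * c) ℤ.- + b) (ℓ ∸ t) c)
    ≡⟨ sym (∑-*ˡ (suc c) (σ t ℤ.* (+ (ℓ C t))) (λ b → R (m ℤ.- + (t * c) ℤ.- + b) (ℓ ∸ t) c)) ⟩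
      ∑[ b < suc c ] (σ t ℤ.* (+ (ℓ C t)) ℤ.* R (m ℤ.- + (t * c) ℤ.- + b) (ℓ ∸ t) c)
    ≡⟨ ∑-cong (suc c) (λ b _ → cong (λ z → σ t ℤ.* (+ (ℓ C t)) ℤ.* R z (ℓ ∸ t) c) (m-n-o≡m-o-n m (+ (t * c)) (+ b))) ⟩
      ∑[ b < suc c ] term t b
    ∎

  last-vanishes : f₁ (suc ℓ) ≡ + 0
  last-vanishes = trans (cong (λ z → σ (suc ℓ) ℤ.* + z ℤ.* X) (k>n⇒nCk≡0 {ℓ} {suc ℓ} ℕP.≤-refl))
                  (trans (cong (ℤ._* X) (ℤP.*-zeroʳ (σ (suc ℓ)))) (ℤP.*-zeroˡ X))
    where X = R (m ℤ.- + (suc ℓ * c)) (suc ℓ ∸ suc ℓ) c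

  first-half : sumFrom1 (suc ℓ) f₁ ≡ ∑< c A ℤ.+ A c
  first-half = begin
      sumFrom1 ℓ f₁ ℤ.+ f₁ (suc ℓ)
    ≡⟨ cong₂ ℤ._+_ (sumFrom1-cong ℓ expand) last-vanishes ⟩
      sumFrom1 ℓ (λ t → ∑[ b < suc c ] term t b) ℤ.+ + 0
    ≡⟨ ℤP.+-identityʳ _ ⟩
      sumFrom1 ℓ (λ t → ∑[ b < suc c ] term t b)
    ≡⟨ sumFrom1-∑-comm ℓ (suc c) term ⟩
      ∑< (suc c) A
    ≡⟨ ∑-init-last c A ⟩
      ∑< c A ℤ.+ A c
    ∎

  second-half : sumFrom1 (suc ℓ) f₂ ≡ R (m ℤ.- + c) ℓ c ℤ.- A c
  second-half = begin
      sumFrom1 (suc ℓ) f₂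
    ≡⟨ sumFrom1-head ℓ f₂ ⟩
      f₂ 1 ℤ.+ sumFrom1 ℓ (f₂ ∘ suc)
    ≡⟨ cong₂ ℤ._+_ first-term (trans (sumFrom1-cong ℓ shifted) (sumFrom1-neg ℓ _)) ⟩
      R (m ℤ.- + c) ℓ c ℤ.- A c
    ∎
    where
    first-term : f₂ 1 ≡ R (m ℤ.- + c) ℓ c
    first-term = trans (ℤP.*-identityˡ _) (cong (λ z → R (m ℤ.- + z) ℓ c) (ℕP.+-identityʳ c))
    shifted : ∀ u → 1 ≤ u → u ≤ ℓ →
      f₂ (suc u) ≡ ℤ.- (σ u ℤ.* (+ (ℓ C u)) ℤ.* R (m ℤ.- + c ℤ.- + (u * c)) (ℓ ∸ u) c)
    shifted (suc u) _ _ =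
      trans (cong (λ z → sgn (suc u) ℤ.* (+ (ℓ C suc u)) ℤ.* R z (ℓ ∸ suc u) c) (sub-+ m (+ c) (+ (suc u * c))))
            (neg-* (sgn u) (+ (ℓ C suc u)) (R (m ℤ.- + c ℤ.- + (suc u * c)) (ℓ ∸ suc u) c))

alternatingSum≡weakComp<-diff : ∀ c ℓ m →
  alternatingSum c ℓ m ≡ weakComp< (suc c) ℓ m ℤ.- weakComp< c ℓ m
alternatingSum≡weakComp<-diff c zero    m = sym (ℤP.+-inverseʳ (weakComp< (suc c) zero m))
alternatingSum≡weakComp<-diff c (suc ℓ) m = begin
    alternatingSum c (suc ℓ) m
  ≡⟨ alternatingSum-rec c ℓ m ⟩
    ∑[ b < c ] alternatingSum c ℓ (m ℤ.- + b) ℤ.+ R (m ℤ.- + c) ℓ c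
  ≡⟨ cong₂ ℤ._+_ (∑-cong c (λ b _ → alternatingSum≡weakComp<-diff c ℓ (m ℤ.- + b))) (R≡weakComp< (m ℤ.- + c) ℓ c) ⟩
    ∑[ b < c ] (W (suc c) b ℤ.- W c b) ℤ.+ W (suc c) c
  ≡⟨ cong (ℤ._+ W (suc c) c) (∑-distrib-- c (W (suc c)) (W c)) ⟩
    (∑< c (W (suc c)) ℤ.- ∑< c (W c)) ℤ.+ W (suc c) c
  ≡⟨ rearrange (∑< c (W (suc c))) (∑< c (W c)) (W (suc c) c) ⟩
    (∑< c (W (suc c)) ℤ.+ W (suc c) c) ℤ.- ∑< c (W c)
  ≡⟨ cong (ℤ._- ∑< c (W c)) (sym (∑-init-last c (W (suc c)))) ⟩
    ∑< (suc c) (W (suc c)) ℤ.- ∑< c (W c)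
  ≡⟨ sym (cong₂ ℤ._-_ (weakComp<-rec (suc c) ℓ m) (weakComp<-rec c ℓ m)) ⟩
    weakComp< (suc c) (suc ℓ) m ℤ.- weakComp< c (suc ℓ) m
  ∎
  where
  W : ℕ → ℕ → ℤ
  W j b = weakComp< j ℓ (m ℤ.- + b)
  rearrange : ∀ (a b d : ℤ) → (a ℤ.- b) ℤ.+ d ≡ (a ℤ.+ d) ℤ.- b
  rearrange = solve-∀

M≡boundedComp-diff : ∀ n ℓ c → + M n ℓ (suc c) ≡ boundedComp n (suc c) ℓ (+ n) ℤ.- boundedComp n c ℓ (+ n)
M≡boundedComp-diff n ℓ c = begin
    + count P? (tuples ℓ (map suc (upTo n)))
  ≡⟨ cong (λ U → + count P? (tuples ℓ U)) (map-upTo suc n) ⟩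
    + count P? (tuples ℓ (applyUpTo suc n))
  ≡⟨ cong +_ (count-≐ P? _ sum≐ (tuples ℓ (applyUpTo suc n))) ⟩
    + count (λ xs → (+ sum xs ℤ.≟ + n) ×-dec (maxL xs ℕ.≟ suc c)) (tuples ℓ (applyUpTo suc n))
  ≡⟨ count-≡suc (λ xs → + sum xs ℤ.≟ + n) maxL c (tuples ℓ (applyUpTo suc n)) ⟩
    boundedComp n (suc c) ℓ (+ n) ℤ.- boundedComp n c ℓ (+ n)
  ∎
  where
  P? = λ (xs : List ℕ) → (sum xs ℕ.≟ n) ×-dec (maxL xs ℕ.≟ suc c)
  sum≐ : (λ xs → sum xs ≡ n × maxL xs ≡ suc c) ≐ (λ xs → + sum xs ≡ + n × maxL xs ≡ suc c)
  sum≐ = (λ (e , e′) → cong (λ s → + s) e , e′) , (λ (e , e′) → ℤP.+-injective e , e′)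

mainTheorem15 : (n ℓ k : ℕ) → .{{NonZero n}} → .{{NonZero ℓ}} → .{{NonZero k}} →
    ℓ + k ∸ 1 ≤ n → n ≤ ℓ * k →
    + M n ℓ k ≡ sumFrom1 ℓ (λ t → sgn (t ∸ 1) ℤ.* (+ (ℓ C t)) ℤ.* R (+ n ℤ.- + (t * (k ∸ 1)) ℤ.- + ℓ) (ℓ ∸ t) (k ∸ 1))
mainTheorem15 n ℓ@(suc l) (suc c) ℓ+c≤n _ = begin
    + M n ℓ (suc c)
  ≡⟨ M≡boundedComp-diff n ℓ c ⟩
    boundedComp n (suc c) ℓ (+ n) ℤ.- boundedComp n c ℓ (+ n)
  ≡⟨ cong₂ ℤ._-_ (boundedComp≡weakComp< k≤n ℓ (+ n)) (boundedComp≡weakComp< (ℕP.≤-trans (ℕP.n≤1+n c) k≤n) ℓ (+ n)) ⟩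
    weakComp< (suc c) ℓ (+ n ℤ.- + ℓ) ℤ.- weakComp< c ℓ (+ n ℤ.- + ℓ)
  ≡⟨ sym (alternatingSum≡weakComp<-diff c ℓ (+ n ℤ.- + ℓ)) ⟩
    alternatingSum c ℓ (+ n ℤ.- + ℓ)
  ≡⟨ sumFrom1-cong ℓ (λ t _ _ → cong (λ z → sgn (t ∸ 1) ℤ.* (+ (ℓ C t)) ℤ.* R z (ℓ ∸ t) c) (m-n-o≡m-o-n (+ n) (+ ℓ) (+ (t * c)))) ⟩
    sumFrom1 ℓ (λ t → sgn (t ∸ 1) ℤ.* (+ (ℓ C t)) ℤ.* R (+ n ℤ.- + (t * c) ℤ.- + ℓ) (ℓ ∸ t) c)
  ∎
  where
  k≤n : suc c ≤ n
  k≤n = ℕP.≤-trans (ℕP.m≤n+m (suc c) l) ℓ+c≤n
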